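{- For every integer $s\ge 0$, the number $p(s)$ of lattice paths in $M(3)$ from $0$ to $sJ$ is $$p(s)=v(sJ)=\binom{3s}{s,\ s,\ s}\sum_{t=0}^{s}\binom{s}{t}^3.$$
   Context: A semi-magic square of size 3 is a $3\times 3$ matrix with non-negative integer entries whose row sums and column sums all equal a common value $\rho(M)$; $M(3)$ is the set of all of them, and $J$ is the all-ones $3\times3$ matrix. A lattice path in $M(3)$ from $0$ to $M$ is a sequence $0=M_0,\dots,M_{\rho(M)}=M$ with each $M_i-M_{i-1}$ a $3\times3$ permutation matrix; $v(M)$ is the number of such paths. -}

module Defs where

open import Data.Nat using (ℕ; zero; suc; _+_; _*_; _!; _/_; _≡ᵇ_)
open import Data.Nat.Properties using (_!≢0; m*n≢0)
open import Data.Nat.Combinatorics using (_C_)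
open import Data.Fin using (Fin; zero; suc)
open import Data.Fin.Properties using (_≟_)
open import Data.Bool using (Bool; true; false; if_then_else_; _∧_; not)
open import Data.List using (List; []; _∷_; map; concatMap; filter; length; upTo; allFin; foldr)
open import Data.Nat.ListAction using (sum)
open import Data.Bool.Properties using (T?)
open import Data.Vec using (Vec; []; _∷_)
open import Relation.Nullary.Decidable using (⌊_⌋)

Mat : Set
Mat = Fin 3 → Fin 3 → ℕ

zeroM : Mat
zeroM _ _ = 0

_+M_ : Mat → Mat → Mat
(A +M B) i j = A i j + B i j

sJ : ℕ → Mat
sJ s _ _ = s

_≡M?_ : Mat → Mat → Bool
A ≡M? B = foldr _∧_ true
  (concatMap (λ i → map (λ j → A i j ≡ᵇ B i j) (allFin 3)) (allFin 3))

perms3 : List (Fin 3 → Fin 3)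
perms3 =
  concatMap (λ a → concatMap (λ b → concatMap (λ c →
    if not ⌊ a ≟ b ⌋ ∧ not ⌊ a ≟ c ⌋ ∧ not ⌊ b ≟ c ⌋
      then ((λ { zero → a ; (suc zero) → b ; (suc (suc zero)) → c }) ∷ [])
      else []) (allFin 3)) (allFin 3)) (allFin 3)

permMat : (Fin 3 → Fin 3) → Mat
permMat σ i j = if ⌊ σ i ≟ j ⌋ then 1 else 0

permMats : List Mat
permMats = map permMat perms3

stepSeqs : (k : ℕ) → List (Vec Mat k)
stepSeqs zero = [] ∷ []
stepSeqs (suc k) = concatMap (λ P → map (P ∷_) (stepSeqs k)) permMats

endpoint : ∀ {k} → Vec Mat k → Mat
endpoint [] = zeroM
endpoint (P ∷ Ps) = P +M endpoint Ps

-- common line sum ρ(M) (read off from the first row; M is assumed semi-magic)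
ρ : Mat → ℕ
ρ M = M zero zero + M zero (suc zero) + M zero (suc (suc zero))

-- A path is determined by its
-- sequence of steps, so we count step sequences of length ρ(M) ending at M.
v : Mat → ℕ
v M = length (filter (λ Ps → T? (endpoint Ps ≡M? M)) (stepSeqs (ρ M)))

multinomial3 : ℕ → ℕ
multinomial3 s = ((3 * s) !) / (s ! * s ! * s !)
  where instance
    _ = s !≢0
    _ = m*n≢0 (s !) (s !) {{s !≢0}} {{s !≢0}}
    _ = m*n≢0 (s ! * s !) (s !) {{m*n≢0 (s !) (s !) {{s !≢0}} {{s !≢0}}}} {{s !≢0}}

sumCubes : ℕ → ℕ
sumCubes s = sum (map (λ t → (s C t) * (s C t) * (s C t)) (upTo (suc s)))

-- A lattice path from 0 to sJ is a word of length 3s in the six permutation matrices, and its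
-- endpoint is the sum of the letters weighted by how often each occurs.  Solving that linear
-- system entrywise shows that the three even permutations must each occur t times and the three
-- odd ones s ∸ t times, for some t ≤ s.  Words with prescribed letter counts are counted by the
-- multinomial coefficient (3s)! / (t!³ (s ∸ t)!³) = (3s)! / (s!)³ · C(s,t)³, and summing over t
-- gives the formula.
module Submission where

open import Defs
open import Data.Nat using (ℕ; zero; suc; _+_; _*_; _∸_; _!; _≤_; NonZero; s≤s; s≤s⁻¹; _≡ᵇ_)
open import Data.Nat.Properties
open import Data.Nat.ListAction using (sum)
open import Data.Nat.ListAction.Properties using (sum-++)
open import Data.Nat.Combinatorics using (_C_; nCk≡n!/k![n-k]!; k![n∸k]!∣n!)
open import Data.Nat.DivMod using (m/n*n≡m)
open import Data.Nat.Divisibility using (divides)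
open import Data.Nat.Solver using (module +-*-Solver)
open +-*-Solver using (solve; _:+_; _:*_; _:=_; con)
open import Algebra.Properties.Monoid.Sum +-0-monoid using (sum-syntax)
open import Algebra.Properties.CommutativeSemigroup +-commutativeSemigroup
  using () renaming (x∙yz≈y∙xz to +-left-comm; interchange to +-interchange)
open import Algebra.Properties.CommutativeSemigroup *-commutativeSemigroup
  using () renaming (x∙yz≈y∙xz to *-left-comm)
open import Data.Bool using (Bool; T)
open import Data.Bool.Properties using (T?)
open import Data.Fin using (Fin; zero; suc)
open import Data.List as L using (List; []; _∷_; _++_; _∷ʳ_; map; concatMap; filter; length; upTo; allFin)
open import Data.List.Properties using (map-∘; map-cong; map-cong-local; map-++; map-tabulate; concatMap-map; map-concatMap; concatMap-cong; upTo-∷ʳ)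
import Data.List.Relation.Unary.All as All
open import Data.List.Relation.Unary.All.Properties
  using (all⁺; all⁻; concat⁺; concat⁻; map⁺; map⁻; tabulate⁺; tabulate⁻; all-upTo)
open import Data.Product using (_×_; _,_; proj₁; proj₂; map₁)
open import Data.Sum using ([_,_])
open import Data.Vec as V using (Vec; []; _∷_; lookup; replicate; _[_]%=_; _[_]≔_)
open import Data.Vec.Properties using (∷-injective; ≡-dec; lookup∘updateAt)
open import Function using (_∘_; id; _⇔_; mk⇔; Equivalence)
open import Relation.Binary.Definitions using (DecidableEquality)
open import Relation.Binary.PropositionalEquality hiding ([_])
open import Relation.Nullary using (Dec; yes; no; ¬_; _×-dec_; contradiction)
open import Relation.Unary using (Pred; Decidable)
open import Level using (Level)

private
  variable
    ℓ₁ ℓ₂ ℓ₃ ℓ₄ : Level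
    A : Set ℓ₁
    B : Set ℓ₂
    P : Set ℓ₃
    Q : Set ℓ₄
    m n k : ℕ

𝟙 : Dec P → ℕ
𝟙 (yes _) = 1
𝟙 (no _)  = 0

𝟙-yes : (P? : Dec P) → P → 𝟙 P? ≡ 1
𝟙-yes (yes _) _  = refl
𝟙-yes (no ¬p) p = contradiction p ¬p

𝟙-no : (P? : Dec P) → ¬ P → 𝟙 P? ≡ 0
𝟙-no (yes p) ¬p = contradiction p ¬p
𝟙-no (no _)  _  = refl

𝟙-cong : (P? : Dec P) (Q? : Dec Q) → P ⇔ Q → 𝟙 P? ≡ 𝟙 Q?
𝟙-cong P? (yes q) P⇔Q = 𝟙-yes P? (Equivalence.from P⇔Q q)
𝟙-cong P? (no ¬q) P⇔Q = 𝟙-no P? (¬q ∘ Equivalence.to P⇔Q)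

𝟙-× : (P? : Dec P) (Q? : Dec Q) → 𝟙 (P? ×-dec Q?) ≡ 𝟙 P? * 𝟙 Q?
𝟙-× (yes _) (yes _) = refl
𝟙-× (yes _) (no _)  = refl
𝟙-× (no _)  _       = refl

count : {P : Pred A ℓ₃} → Decidable P → List A → ℕ
count P? xs = sum (map (𝟙 ∘ P?) xs)

length-filter≡count : {P : Pred A ℓ₃} (P? : Decidable P) (xs : List A) →
                      length (filter P? xs) ≡ count P? xs
length-filter≡count P? []       = refl
length-filter≡count P? (x ∷ xs) with P? x
... | yes _ = cong suc (length-filter≡count P? xs)
... | no _  = length-filter≡count P? xs

module _ (f : A → ℕ) where

  sum-map-++ : ∀ xs ys → sum (map f (xs ++ ys)) ≡ sum (map f xs) + sum (map f ys)
  sum-map-++ xs ys = trans (cong sum (map-++ f xs ys)) (sum-++ (map f xs) (map f ys))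

  sum-map-concatMap : (g : B → List A) (xs : List B) →
                      sum (map f (concatMap g xs)) ≡ sum (map (λ x → sum (map f (g x))) xs)
  sum-map-concatMap g []       = refl
  sum-map-concatMap g (x ∷ xs) =
    trans (sum-map-++ (g x) (concatMap g xs)) (cong (_ +_) (sum-map-concatMap g xs))

  sum-map-*ˡ : ∀ m xs → sum (map (λ x → m * f x) xs) ≡ m * sum (map f xs)
  sum-map-*ˡ m []       = sym (*-zeroʳ m)
  sum-map-*ˡ m (x ∷ xs) = trans (cong (m * f x +_) (sum-map-*ˡ m xs)) (sym (*-distribˡ-+ m (f x) _))

  sum-map-*ʳ : ∀ m xs → sum (map (λ x → f x * m) xs) ≡ sum (map f xs) * m
  sum-map-*ʳ m []       = refl
  sum-map-*ʳ m (x ∷ xs) = trans (cong (f x * m +_) (sum-map-*ʳ m xs)) (sym (*-distribʳ-+ m (f x) _))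

sum-map-map : (f : B → ℕ) (g : A → B) (xs : List A) → sum (map f (map g xs)) ≡ sum (map (f ∘ g) xs)
sum-map-map f g xs = cong sum (sym (map-∘ xs))

sum-map-cong : {f g : A → ℕ} → (∀ x → f x ≡ g x) → ∀ xs → sum (map f xs) ≡ sum (map g xs)
sum-map-cong f≗g xs = cong sum (map-cong f≗g xs)

sum-map-0 : (xs : List A) → sum (map (λ _ → 0) xs) ≡ 0
sum-map-0 []       = refl
sum-map-0 (_ ∷ xs) = sum-map-0 xs

sum-map-+ : (f g : A → ℕ) (xs : List A) →
            sum (map (λ x → f x + g x) xs) ≡ sum (map f xs) + sum (map g xs)
sum-map-+ f g []       = refl
sum-map-+ f g (x ∷ xs) =
  trans (cong (f x + g x +_) (sum-map-+ f g xs)) (+-interchange (f x) (g x) (sum (map f xs)) (sum (map g xs)))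

sum-map-swap : (f : A → B → ℕ) (xs : List A) (ys : List B) →
               sum (map (λ x → sum (map (f x) ys)) xs) ≡ sum (map (λ y → sum (map (λ x → f x y) xs)) ys)
sum-map-swap f []       ys = sym (sum-map-0 ys)
sum-map-swap f (x ∷ xs) ys =
  trans (cong (sum (map (f x) ys) +_) (sum-map-swap f xs ys))
        (sym (sum-map-+ (f x) (λ y → sum (map (λ x → f x y) xs)) ys))

count-map : {P : Pred B ℓ₃} (P? : Decidable P) (f : A → B) (xs : List A) →
            count P? (map f xs) ≡ count (P? ∘ f) xs
count-map P? f = sum-map-map (𝟙 ∘ P?) f

count-cong : {P : Pred A ℓ₃} {Q : Pred A ℓ₄} (P? : Decidable P) (Q? : Decidable Q) →
             (∀ x → P x ⇔ Q x) → ∀ xs → count P? xs ≡ count Q? xs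
count-cong P? Q? P⇔Q = sum-map-cong (λ x → 𝟙-cong (P? x) (Q? x) (P⇔Q x))

count-none : {P : Pred A ℓ₃} (P? : Decidable P) → (∀ x → ¬ P x) → ∀ xs → count P? xs ≡ 0
count-none P? ¬P xs = trans (sum-map-cong (λ x → 𝟙-no (P? x) (¬P x)) xs) (sum-map-0 xs)

𝟙-<-suc : ∀ a N → 𝟙 (a <? N) + 𝟙 (a ≟ N) ≡ 𝟙 (a <? suc N)
𝟙-<-suc a N with a <? N | a ≟ N
... | yes a<N | a≟N     = trans (cong suc (𝟙-no a≟N (<⇒≢ a<N))) (sym (𝟙-yes (a <? suc N) (m<n⇒m<1+n a<N)))
... | no _    | yes refl = sym (𝟙-yes (a <? suc a) (n<1+n a))
... | no a≮N  | no a≢N  = sym (𝟙-no (a <? suc N) λ a<1+N → [ a≮N , a≢N ] (m≤n⇒m<n∨m≡n (s≤s⁻¹ a<1+N)))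

count-≡-upTo : ∀ a N → count (a ≟_) (upTo N) ≡ 𝟙 (a <? N)
count-≡-upTo a zero    = refl
count-≡-upTo a (suc N) = begin
  count (a ≟_) (upTo (suc N))                     ≡⟨ cong (count (a ≟_)) (sym (upTo-∷ʳ N)) ⟩
  count (a ≟_) (upTo N ∷ʳ N)                      ≡⟨ sum-map-++ (𝟙 ∘ (a ≟_)) (upTo N) L.[ N ] ⟩
  count (a ≟_) (upTo N) + (𝟙 (a ≟ N) + 0)         ≡⟨ cong₂ _+_ (count-≡-upTo a N) (+-identityʳ _) ⟩
  𝟙 (a <? N) + 𝟙 (a ≟ N)                          ≡⟨ 𝟙-<-suc a N ⟩
  𝟙 (a <? suc N)                                  ∎
  where open ≡-Reasoning

words : List A → (k : ℕ) → List (Vec A k)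
words xs zero    = [] ∷ []
words xs (suc k) = concatMap (λ x → map (x ∷_) (words xs k)) xs

words-map : (f : A → B) (xs : List A) (k : ℕ) → words (map f xs) k ≡ map (V.map f) (words xs k)
words-map f xs zero    = refl
words-map f xs (suc k) = begin
  concatMap (λ y → map (y ∷_) (words (map f xs) k)) (map f xs)
    ≡⟨ concatMap-map _ f xs ⟩
  concatMap (λ x → map (f x ∷_) (words (map f xs) k)) xs
    ≡⟨ concatMap-cong (λ x → trans (cong (map (f x ∷_)) (words-map f xs k)) (sym (map-∘ (words xs k)))) xs ⟩
  concatMap (λ x → map (V.map f ∘ (x ∷_)) (words xs k)) xs
    ≡⟨ concatMap-cong (λ x → map-∘ (words xs k)) xs ⟩
  concatMap (λ x → map (V.map f) (map (x ∷_) (words xs k))) xs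
    ≡⟨ sym (map-concatMap (V.map f) _ xs) ⟩
  map (V.map f) (concatMap (λ x → map (x ∷_) (words xs k)) xs) ∎
  where open ≡-Reasoning

letterCounts : Vec (Fin n) k → Vec ℕ n
letterCounts []      = replicate _ 0
letterCounts (i ∷ u) = letterCounts u [ i ]%= suc

infix 4 _≟ᶜ_
_≟ᶜ_ : DecidableEquality (Vec ℕ n)
_≟ᶜ_ = ≡-dec _≟_

wordsWithCounts : (k : ℕ) → Vec ℕ n → ℕ
wordsWithCounts {n} k c = count (λ u → letterCounts u ≟ᶜ c) (words (allFin n) k)

factorialProduct : Vec ℕ n → ℕ
factorialProduct []       = 1
factorialProduct (x ∷ xs) = x ! * factorialProduct xs

factorialProduct≢0 : (c : Vec ℕ n) → NonZero (factorialProduct c)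
factorialProduct≢0 []       = _
factorialProduct≢0 (x ∷ xs) = m*n≢0 (x !) _ {{x !≢0}} {{factorialProduct≢0 xs}}

factorialProduct-replicate : ∀ n → factorialProduct (replicate n 0) ≡ 1
factorialProduct-replicate zero    = refl
factorialProduct-replicate (suc n) = trans (+-identityʳ _) (factorialProduct-replicate n)

sum≡0⇒≡replicate : (c : Vec ℕ n) → V.sum c ≡ 0 → c ≡ replicate n 0
sum≡0⇒≡replicate []       _  = refl
sum≡0⇒≡replicate (x ∷ xs) eq =
  cong₂ _∷_ (m+n≡0⇒m≡0 x eq) (sum≡0⇒≡replicate xs (m+n≡0⇒n≡0 x eq))

sum-map-lookup-allFin : (c : Vec ℕ n) → sum (map (lookup c) (allFin n)) ≡ V.sum c
sum-map-lookup-allFin []       = refl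
sum-map-lookup-allFin (x ∷ xs) = cong (x +_) (begin
  sum (map (lookup (x ∷ xs)) (L.tabulate suc)) ≡⟨ cong sum (map-tabulate suc (lookup (x ∷ xs))) ⟩
  sum (L.tabulate (lookup xs))                 ≡⟨ cong sum (sym (map-tabulate id (lookup xs))) ⟩
  sum (map (lookup xs) (allFin _))             ≡⟨ sum-map-lookup-allFin xs ⟩
  V.sum xs                                     ∎)
  where open ≡-Reasoning

sum-decrement : ∀ (i : Fin n) (c : Vec ℕ n) → lookup c i ≡ suc m → V.sum c ≡ suc (V.sum (c [ i ]≔ m))
sum-decrement zero    (x ∷ xs) refl = refl
sum-decrement (suc i) (x ∷ xs) eq   = trans (cong (x +_) (sum-decrement i xs eq)) (+-suc x _)

factorialProduct-decrement : ∀ (i : Fin n) (c : Vec ℕ n) → lookup c i ≡ suc m →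
                             factorialProduct c ≡ suc m * factorialProduct (c [ i ]≔ m)
factorialProduct-decrement {m = m} zero (x ∷ xs) refl = *-assoc (suc m) (m !) _
factorialProduct-decrement {m = m} (suc i) (x ∷ xs) eq =
  trans (cong (x ! *_) (factorialProduct-decrement i xs eq)) (*-left-comm (x !) (suc m) _)

updateAt-suc≢ : ∀ (i : Fin n) {x c : Vec ℕ n} → lookup c i ≡ 0 → x [ i ]%= suc ≢ c
updateAt-suc≢ i {x} {c} cᵢ≡0 e = 1+n≢0 (begin
  suc (lookup x i)         ≡⟨ lookup∘updateAt i x ⟨
  lookup (x [ i ]%= suc) i ≡⟨ cong (λ v → lookup v i) e ⟩
  lookup c i               ≡⟨ cᵢ≡0 ⟩
  0                        ∎)
  where open ≡-Reasoning

updateAt-suc≡⇔ : ∀ (i : Fin n) {x c : Vec ℕ n} → lookup c i ≡ suc m →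
                 (x [ i ]%= suc ≡ c) ⇔ (x ≡ c [ i ]≔ m)
updateAt-suc≡⇔ {m = m} zero {x ∷ xs} {.(suc m) ∷ cs} refl =
  mk⇔ (λ e → cong₂ _∷_ (suc-injective (proj₁ (∷-injective e))) (proj₂ (∷-injective e)))
      (cong (_[ zero ]%= suc))
updateAt-suc≡⇔ (suc i) {x ∷ xs} {c ∷ cs} eq =
  mk⇔ (λ e → cong₂ _∷_ (proj₁ (∷-injective e)) (Equivalence.to   ih (proj₂ (∷-injective e))))
      (λ e → cong₂ _∷_ (proj₁ (∷-injective e)) (Equivalence.from ih (proj₂ (∷-injective e))))
  where ih = updateAt-suc≡⇔ i {xs} {cs} eq

wordsWithCounts-suc : ∀ k (c : Vec ℕ n) → wordsWithCounts (suc k) c ≡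
  sum (map (λ i → count (λ u → letterCounts u [ i ]%= suc ≟ᶜ c) (words (allFin n) k)) (allFin n))
wordsWithCounts-suc {n} k c =
  trans (sum-map-concatMap (𝟙 ∘ (λ u → letterCounts u ≟ᶜ c)) (λ i → map (i ∷_) (words (allFin n) k)) (allFin n))
        (sum-map-cong (λ i → count-map (λ u → letterCounts u ≟ᶜ c) (i ∷_) (words (allFin n) k)) (allFin n))

wordsWithCounts-firstLetter : ∀ k (i : Fin n) (c : Vec ℕ n) →
  (∀ c′ → V.sum c′ ≡ k → wordsWithCounts k c′ * factorialProduct c′ ≡ k !) → V.sum c ≡ suc k →
  count (λ u → letterCounts u [ i ]%= suc ≟ᶜ c) (words (allFin n) k) * factorialProduct c ≡ lookup c i * k !
wordsWithCounts-firstLetter {n} k i c ih Σc≡1+k with lookup c i in cᵢ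
... | zero  = cong (_* factorialProduct c)
  (count-none (λ u → letterCounts u [ i ]%= suc ≟ᶜ c) (λ u → updateAt-suc≢ i cᵢ) (words (allFin n) k))
... | suc m = begin
  count (λ u → letterCounts u [ i ]%= suc ≟ᶜ c) (words (allFin n) k) * factorialProduct c
    ≡⟨ cong₂ _*_ (count-cong _ _ (λ u → updateAt-suc≡⇔ i cᵢ) (words (allFin n) k))
                 (factorialProduct-decrement i c cᵢ) ⟩
  wordsWithCounts k c′ * (suc m * factorialProduct c′)
    ≡⟨ *-left-comm (wordsWithCounts k c′) (suc m) _ ⟩
  suc m * (wordsWithCounts k c′ * factorialProduct c′)
    ≡⟨ cong (suc m *_) (ih c′ (suc-injective (trans (sym (sum-decrement i c cᵢ)) Σc≡1+k))) ⟩
  suc m * k ! ∎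
  where
  open ≡-Reasoning
  c′ = c [ i ]≔ m

wordsWithCounts-multinomial : ∀ k (c : Vec ℕ n) → V.sum c ≡ k →
                              wordsWithCounts k c * factorialProduct c ≡ k !
wordsWithCounts-multinomial {n} zero c Σc≡0 rewrite sum≡0⇒≡replicate c Σc≡0 =
  cong₂ _*_ (cong (_+ 0) (𝟙-yes (replicate n 0 ≟ᶜ replicate n 0) refl)) (factorialProduct-replicate n)
wordsWithCounts-multinomial {n} (suc k) c Σc≡1+k = begin
  wordsWithCounts (suc k) c * factorialProduct c
    ≡⟨ cong (_* factorialProduct c) (wordsWithCounts-suc k c) ⟩
  sum (map N (allFin n)) * factorialProduct c
    ≡⟨ sym (sum-map-*ʳ N (factorialProduct c) (allFin n)) ⟩
  sum (map (λ i → N i * factorialProduct c) (allFin n))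
    ≡⟨ sum-map-cong (λ i → wordsWithCounts-firstLetter k i c (wordsWithCounts-multinomial k) Σc≡1+k) (allFin n) ⟩
  sum (map (λ i → lookup c i * k !) (allFin n))
    ≡⟨ sum-map-*ʳ (lookup c) (k !) (allFin n) ⟩
  sum (map (lookup c) (allFin n)) * k !
    ≡⟨ cong (_* k !) (trans (sum-map-lookup-allFin c) Σc≡1+k) ⟩
  suc k * k ! ∎
  where
  open ≡-Reasoning
  N : Fin n → ℕ
  N i = count (λ u → letterCounts u [ i ]%= suc ≟ᶜ c) (words (allFin n) k)

linearCombination : (Fin n → Mat) → Vec ℕ n → Mat
linearCombination {n} f c i j = ∑[ l < n ] (f l i j * lookup c l)

∑-weights-replicate : (g : Fin n → ℕ) → ∑[ l < n ] (g l * lookup (replicate n 0) l) ≡ 0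
∑-weights-replicate {zero}  g = refl
∑-weights-replicate {suc n} g = trans (cong₂ _+_ (*-zeroʳ (g zero)) (∑-weights-replicate (g ∘ suc))) refl

∑-weights-updateAt-suc : (g : Fin n → ℕ) (c : Vec ℕ n) (i : Fin n) →
  ∑[ l < n ] (g l * lookup (c [ i ]%= suc) l) ≡ g i + ∑[ l < n ] (g l * lookup c l)
∑-weights-updateAt-suc {suc n} g (x ∷ xs) zero =
  trans (cong (_+ rest) (*-suc (g zero) x)) (+-assoc (g zero) (g zero * x) rest)
  where rest = ∑[ l < n ] (g (suc l) * lookup xs l)
∑-weights-updateAt-suc g (x ∷ xs) (suc i) =
  trans (cong (g zero * x +_) (∑-weights-updateAt-suc (g ∘ suc) xs i)) (+-left-comm (g zero * x) (g (suc i)) _)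

endpoint-map : (f : Fin n → Mat) (u : Vec (Fin n) k) →
               ∀ i j → endpoint (V.map f u) i j ≡ linearCombination f (letterCounts u) i j
endpoint-map f []      i j = sym (∑-weights-replicate (λ l → f l i j))
endpoint-map f (l ∷ u) i j =
  trans (cong (f l i j +_) (endpoint-map f u i j))
        (sym (∑-weights-updateAt-suc (λ l′ → f l′ i j) (letterCounts u) l))

≡M?⇔ : {A B : Mat} → T (A ≡M? B) ⇔ (∀ i j → A i j ≡ B i j)
≡M?⇔ {A} {B} = mk⇔
  (λ t i j → ≡ᵇ⇒≡ (A i j) (B i j)
    (tabulate⁻ {f = id} (map⁻ {f = cell i} (tabulate⁻ {f = id} (map⁻ {f = row}
      (concat⁻ {xss = map row (allFin 3)} (all⁺ id (concatMap row (allFin 3)) t))) i)) j))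
  (λ e → all⁻ id {concatMap row (allFin 3)} (concat⁺ (map⁺ {f = row}
    (tabulate⁺ {f = id} λ i → map⁺ {f = cell i} (tabulate⁺ {f = id} λ j → ≡⇒≡ᵇ (A i j) (B i j) (e i j))))))
  where
  cell : Fin 3 → Fin 3 → Bool
  cell i j = A i j ≡ᵇ B i j
  row : Fin 3 → List Bool
  row i = map (cell i) (allFin 3)

perm : Fin 6 → Mat
perm = L.lookup permMats

stepSeqs≡words : ∀ k → stepSeqs k ≡ map (V.map perm) (words (allFin 6) k)
stepSeqs≡words k = trans (stepSeqs≡words-permMats k) (words-map perm (allFin 6) k)
  where
  stepSeqs≡words-permMats : ∀ k → stepSeqs k ≡ words permMats k
  stepSeqs≡words-permMats zero    = refl
  stepSeqs≡words-permMats (suc k) =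
    cong (λ ws → concatMap (λ P → map (P ∷_) ws) permMats) (stepSeqs≡words-permMats k)

-- perms3 lists the permutations lexicographically, so the even ones sit at positions 0, 3 and 4.
parityCounts : ℕ → ℕ → Vec ℕ 6
parityCounts a b = a ∷ b ∷ b ∷ a ∷ a ∷ b ∷ []

-- Each entry of linearCombination perm c reduces to x + 0 + (y + 0 + 0) for two counts x, y of c.
pairSum : ∀ x y → x + 0 + (y + 0 + 0) ≡ x + y
pairSum x y = cong₂ _+_ (+-identityʳ x) (trans (+-identityʳ (y + 0)) (+-identityʳ y))

parityCounts-sJ : ∀ {a b s} → a + b ≡ s → ∀ i j → linearCombination perm (parityCounts a b) i j ≡ s
parityCounts-sJ {a} {b} {s} a+b≡s = λ
  { zero zero → ab ; zero (suc zero) → ba ; zero (suc (suc zero)) → ab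
  ; (suc zero) zero → ba ; (suc zero) (suc zero) → ab ; (suc zero) (suc (suc zero)) → ba
  ; (suc (suc zero)) zero → ab ; (suc (suc zero)) (suc zero) → ba ; (suc (suc zero)) (suc (suc zero)) → ab }
  where
  ab : a + 0 + (b + 0 + 0) ≡ s
  ab = trans (pairSum a b) a+b≡s
  ba : b + 0 + (a + 0 + 0) ≡ s
  ba = trans (pairSum b a) (trans (+-comm b a) a+b≡s)

sJ-solution : ∀ {s} (c : Vec ℕ 6) → (∀ i j → linearCombination perm c i j ≡ s) →
              lookup c zero ≤ s × c ≡ parityCounts (lookup c zero) (s ∸ lookup c zero)
sJ-solution {s} c@(x₀ ∷ x₁ ∷ x₂ ∷ x₃ ∷ x₄ ∷ x₅ ∷ []) sums≡s =
  subst (x₀ ≤_) e₀₁ (m≤m+n x₀ x₁) ,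
  cong (x₀ ∷_) (cong₂ _∷_ (complement e₀₁) (cong₂ _∷_ (complement e₀₂) (cong₂ _∷_ x₃≡x₀
    (cong₂ _∷_ x₄≡x₀ (cong₂ _∷_ (complement e₀₅) refl)))))
  where
  entry : ∀ i j x y → linearCombination perm c i j ≡ x + 0 + (y + 0 + 0) → x + y ≡ s
  entry i j x y eq = trans (sym (pairSum x y)) (trans (sym eq) (sums≡s i j))
  e₀₁ : x₀ + x₁ ≡ s
  e₀₁ = entry zero zero x₀ x₁ refl
  e₀₅ : x₀ + x₅ ≡ s
  e₀₅ = entry (suc zero) (suc zero) x₀ x₅ refl
  e₀₂ : x₀ + x₂ ≡ s
  e₀₂ = entry (suc (suc zero)) (suc (suc zero)) x₀ x₂ refl
  e₁₃ : x₁ + x₃ ≡ s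
  e₁₃ = entry (suc zero) (suc (suc zero)) x₁ x₃ refl
  e₁₄ : x₁ + x₄ ≡ s
  e₁₄ = entry (suc (suc zero)) (suc zero) x₁ x₄ refl
  complement : ∀ {x y} → x + y ≡ s → y ≡ s ∸ x
  complement {x} {y} e = trans (sym (m+n∸m≡n x y)) (cong (_∸ x) e)
  x₃≡x₀ : x₃ ≡ x₀
  x₃≡x₀ = +-cancelˡ-≡ x₁ x₃ x₀ (trans e₁₃ (sym (trans (+-comm x₁ x₀) e₀₁)))
  x₄≡x₀ : x₄ ≡ x₀
  x₄≡x₀ = +-cancelˡ-≡ x₁ x₄ x₀ (trans e₁₄ (sym (trans (+-comm x₁ x₀) e₀₁)))

parityCounts⇔ : ∀ s (c : Vec ℕ 6) b →
  (lookup c zero ≡ b × c ≡ parityCounts (lookup c zero) (s ∸ lookup c zero)) ⇔ (c ≡ parityCounts b (s ∸ b))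
parityCounts⇔ s c b = mk⇔
  (λ (a≡b , e) → trans e (cong (λ a → parityCounts a (s ∸ a)) a≡b))
  (λ e → let a≡b = cong (λ v → lookup v zero) e in a≡b , trans e (cong (λ a → parityCounts a (s ∸ a)) (sym a≡b)))

reachesSJ⇔ : ∀ s (u : Vec (Fin 6) k) → let c = letterCounts u; a = lookup c zero in
             T (endpoint (V.map perm u) ≡M? sJ s) ⇔ (a ≤ s × c ≡ parityCounts a (s ∸ a))
reachesSJ⇔ s u = mk⇔
  (λ t → sJ-solution c (λ i j → trans (sym (endpoint-map perm u i j)) (Equivalence.to (≡M?⇔ {E}) t i j)))
  (λ (a≤s , c≡) → Equivalence.from (≡M?⇔ {E}) λ i j →
     trans (endpoint-map perm u i j)
           (subst (λ c → linearCombination perm c i j ≡ s) (sym c≡) (parityCounts-sJ (m+[n∸m]≡n a≤s) i j)))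
  where
  c = letterCounts u
  E = endpoint (V.map perm u)

reachesSJ-indicator : ∀ s (u : Vec (Fin 6) k) → 𝟙 (T? (endpoint (V.map perm u) ≡M? sJ s)) ≡
                      count (λ b → letterCounts u ≟ᶜ parityCounts b (s ∸ b)) (upTo (suc s))
reachesSJ-indicator s u = begin
  𝟙 (T? (endpoint (V.map perm u) ≡M? sJ s))
    ≡⟨ 𝟙-cong _ (a <? suc s ×-dec c ≟ᶜ parity a)
         (mk⇔ (map₁ s≤s ∘ Equivalence.to (reachesSJ⇔ s u)) (Equivalence.from (reachesSJ⇔ s u) ∘ map₁ s≤s⁻¹)) ⟩
  𝟙 (a <? suc s ×-dec c ≟ᶜ parity a)
    ≡⟨ 𝟙-× (a <? suc s) (c ≟ᶜ parity a) ⟩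
  𝟙 (a <? suc s) * 𝟙 (c ≟ᶜ parity a)
    ≡⟨ cong (_* 𝟙 (c ≟ᶜ parity a)) (sym (count-≡-upTo a (suc s))) ⟩
  count (a ≟_) (upTo (suc s)) * 𝟙 (c ≟ᶜ parity a)
    ≡⟨ sym (sum-map-*ʳ (𝟙 ∘ (a ≟_)) (𝟙 (c ≟ᶜ parity a)) (upTo (suc s))) ⟩
  sum (map (λ b → 𝟙 (a ≟ b) * 𝟙 (c ≟ᶜ parity a)) (upTo (suc s)))
    ≡⟨ sum-map-cong (λ b → trans (sym (𝟙-× (a ≟ b) (c ≟ᶜ parity a)))
                                 (𝟙-cong _ (c ≟ᶜ parity b) (parityCounts⇔ s c b))) (upTo (suc s)) ⟩
  count (λ b → c ≟ᶜ parity b) (upTo (suc s)) ∎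
  where
  open ≡-Reasoning
  c = letterCounts u
  a = lookup c zero
  parity : ℕ → Vec ℕ 6
  parity b = parityCounts b (s ∸ b)

binomial-factorials : ∀ {n k} → k ≤ n → (n C k) * (k ! * (n ∸ k) !) ≡ n !
binomial-factorials {n} {k} k≤n =
  trans (cong (_* (k ! * (n ∸ k) !)) (nCk≡n!/k![n-k]! k≤n))
        (m/n*n≡m {{m*n≢0 (k !) ((n ∸ k) !) {{k !≢0}} {{(n ∸ k) !≢0}}}} (k![n∸k]!∣n! k≤n))

multinomial3-factorials : ∀ s → multinomial3 s * (s ! * s ! * s !) ≡ (3 * s) !
multinomial3-factorials s = m/n*n≡m {{s!³≢0}} (divides ((3s C s) * (2s C s)) (begin
  (3 * s) !
    ≡⟨ binomial-factorials (m≤m+n s 2s) ⟨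
  (3s C s) * (s ! * (3s ∸ s) !)
    ≡⟨ cong (λ m → (3s C s) * (s ! * m !)) (m+n∸m≡n s 2s) ⟩
  (3s C s) * (s ! * 2s !)
    ≡⟨ cong (λ m → (3s C s) * (s ! * m)) (binomial-factorials (m≤m+n s (s + 0))) ⟨
  (3s C s) * (s ! * ((2s C s) * (s ! * (2s ∸ s) !)))
    ≡⟨ cong (λ m → (3s C s) * (s ! * ((2s C s) * (s ! * m !)))) (trans (m+n∸m≡n s (s + 0)) (+-identityʳ s)) ⟩
  (3s C s) * (s ! * ((2s C s) * (s ! * s !)))
    ≡⟨ solve 3 (λ x y f → x :* (f :* (y :* (f :* f))) := x :* y :* (f :* f :* f)) refl (3s C s) (2s C s) (s !) ⟩
  (3s C s) * (2s C s) * (s ! * s ! * s !) ∎))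
  where
  open ≡-Reasoning
  2s 3s : ℕ
  2s = s + (s + 0)
  3s = 3 * s
  s!³≢0 : NonZero (s ! * s ! * s !)
  s!³≢0 = m*n≢0 (s ! * s !) (s !) {{m*n≢0 (s !) (s !) {{s !≢0}} {{s !≢0}}}} {{s !≢0}}

wordsWithCounts-parityCounts : ∀ {s b} → b ≤ s →
  wordsWithCounts (s + s + s) (parityCounts b (s ∸ b)) ≡ multinomial3 s * ((s C b) * (s C b) * (s C b))
wordsWithCounts-parityCounts {s} {b} b≤s =
  *-cancelʳ-≡ _ _ (factorialProduct c) {{factorialProduct≢0 c}} (begin
    wordsWithCounts (s + s + s) c * factorialProduct c
      ≡⟨ wordsWithCounts-multinomial (s + s + s) c Σc ⟩
    (s + s + s) !
      ≡⟨ cong _! (solve 1 (λ s → s :+ s :+ s := con 3 :* s) refl s) ⟩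
    (3 * s) !
      ≡⟨ sym (multinomial3-factorials s) ⟩
    multinomial3 s * (s ! * s ! * s !)
      ≡⟨ cong (λ m → multinomial3 s * (m * m * m)) (sym (binomial-factorials b≤s)) ⟩
    multinomial3 s * ((s C b) * b!t! * ((s C b) * b!t!) * ((s C b) * b!t!))
      ≡⟨ solve 4 (λ M C x y → M :* (C :* (x :* y) :* (C :* (x :* y)) :* (C :* (x :* y)))
                            := M :* (C :* C :* C) :* (x :* (y :* (y :* (x :* (x :* (y :* con 1)))))))
               refl (multinomial3 s) (s C b) (b !) ((s ∸ b) !) ⟩
    multinomial3 s * ((s C b) * (s C b) * (s C b)) * factorialProduct c ∎)
  where
  open ≡-Reasoning
  t = s ∸ b
  c = parityCounts b t
  b!t! = b ! * t !
  Σc : V.sum c ≡ s + s + s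
  Σc = trans (solve 2 (λ b t → b :+ (t :+ (t :+ (b :+ (b :+ (t :+ con 0))))) := (b :+ t) :+ (b :+ t) :+ (b :+ t)) refl b t)
             (cong (λ m → m + m + m) (m+[n∸m]≡n b≤s))

corollary5p4 : (s : ℕ) → v (sJ s) ≡ multinomial3 s * sumCubes s
corollary5p4 s = begin
  v (sJ s)
    ≡⟨ length-filter≡count reaches (stepSeqs steps) ⟩
  count reaches (stepSeqs steps)
    ≡⟨ cong (count reaches) (stepSeqs≡words steps) ⟩
  count reaches (map (V.map perm) (words (allFin 6) steps))
    ≡⟨ count-map reaches (V.map perm) (words (allFin 6) steps) ⟩
  count (reaches ∘ V.map perm) (words (allFin 6) steps)
    ≡⟨ sum-map-cong (reachesSJ-indicator s) (words (allFin 6) steps) ⟩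
  sum (map (λ u → count (λ b → letterCounts u ≟ᶜ parity b) (upTo (suc s))) (words (allFin 6) steps))
    ≡⟨ sum-map-swap (λ u b → 𝟙 (letterCounts u ≟ᶜ parity b)) (words (allFin 6) steps) (upTo (suc s)) ⟩
  sum (map (λ b → wordsWithCounts steps (parity b)) (upTo (suc s)))
    ≡⟨ cong sum (map-cong-local (All.map (wordsWithCounts-parityCounts ∘ s≤s⁻¹) (all-upTo (suc s)))) ⟩
  sum (map (λ b → multinomial3 s * ((s C b) * (s C b) * (s C b))) (upTo (suc s)))
    ≡⟨ sum-map-*ˡ (λ b → (s C b) * (s C b) * (s C b)) (multinomial3 s) (upTo (suc s)) ⟩
  multinomial3 s * sumCubes s ∎
  where
  open ≡-Reasoning
  steps = s + s + s
  reaches : Decidable (λ (w : Vec Mat steps) → T (endpoint w ≡M? sJ s))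
  reaches w = T? (endpoint w ≡M? sJ s)
  parity : ℕ → Vec ℕ 6
  parity b = parityCounts b (s ∸ b)
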